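{- The property $\mathsf{PR}$ (having both $\mathsf{PR_{ee}}$ and $\mathsf{PR_{hc}^\ell}$) is not modally definable on introspective ETL forests: there is no set $\Gamma$ of ETL formulas such that for every ETL forest $\mathcal{F}$ whose accessibility relation is transitive and Euclidean, all formulas of $\Gamma$ are valid on $\mathcal{F}$ if and only if $\mathcal{F}$ has $\mathsf{PR}$. (Consequently $\mathsf{PR}$ is not modally definable on the class of all ETL forests either.)
   Context: Fix a finite set $E$ of events. An ETL forest consists of finitely many pairwise disjoint trees, each being a copy of a finite prefix-closed set of event sequences with its own root (empty history); its set $H$ of histories is the union of the nodes of all trees, and $\sim\subseteq H\times H$ is an arbitrary relation, possibly relating histories of different trees. Within each tree write $h\leadsto h'$ if $h'=he$ for an event $e$, and $\preceq$ for the prefix relation. $[h]_\sim=\{h':h\sim h'\}$. Transitive and Euclidean ($h\sim h'$, $h\sim h''$ imply $h'\sim h''$) relations are called introspective. For a history $h=e_1\dots e_\ell$ in a tree with root $r$, $\mathrm{EE}(h)$ is the sequence $[r]_\sim,[re_1]_\sim,\dots,[re_1\dots e_\ell]_\sim$; $\mathrm{EE}(h)\approx\mathrm{EE}(h')$ iff equal after collapsing consecutive repeated sets. $\mathsf{PR_{ee}}$: $h\sim h'$ implies $\mathrm{EE}(h)\approx\mathrm{EE}(h')$. $\mathsf{PR_{hc}^\ell}$: for all $h,h'$ and events $e$ with $he\sim h'$: (i) $h\sim h'$, or (ii) $h\sim h''\leadsto h'$ for some $h''$, or (iii) $he\sim h''\leadsto h'$ for some $h''$. ETL formulas: $\varphi::=p\mid\neg\varphi\mid\varphi\wedge\varphi\mid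 K\varphi\mid\langle e\rangle\varphi$. Given a valuation $V$ (atoms to subsets of $H$), $K\varphi$ holds at $h$ iff $\varphi$ holds at all $h'$ with $h\sim h'$; $\langle e\rangle\varphi$ holds at $h$ iff $he$ is a history of the same tree and $\varphi$ holds there. A formula is valid on the forest iff it holds at every history under every valuation. -}

module Defs where

open import Data.Nat using (ℕ)
open import Data.Fin using (Fin)
open import Data.Bool using (Bool; true)
open import Data.List using (List; []; _∷_; _++_; [_])
open import Data.List.Membership.Propositional using (_∈_)
open import Data.Product using (Σ; ∃; _×_; _,_; proj₁)
open import Data.Sum using (_⊎_)
open import Relation.Nullary using (¬_)
open import Relation.Binary.PropositionalEquality using (_≡_)
open import Function.Bundles using (_⇔_)

module ETL (E : Set) where

  -- Trees: finite prefix-closed sets of event sequences (containing the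
  -- empty sequence, i.e. the root).  A sequence e₁…eₗ is the list
  -- e₁ ∷ … ∷ eₗ ∷ [], and h e is h ++ [ e ].
  record Tree : Set where
    field
      mem    : List E → Bool
      root   : mem [] ≡ true
      closed : ∀ s e → mem (s ++ [ e ]) ≡ true → mem s ≡ true
      finite : Σ (List (List E)) λ L → ∀ s → mem s ≡ true → s ∈ L
  open Tree public

  -- Histories of a family of k pairwise disjoint trees: a tree index
  -- together with a node of that tree.
  Hist : (k : ℕ) → (Fin k → Tree) → Set
  Hist k T = Σ (Fin k) λ i → Σ (List E) λ s → mem (T i) s ≡ true

  record Forest : Set₁ where
    field
      k    : ℕ
      tree : Fin k → Tree
      _∼_  : Hist k tree → Hist k tree → Set

    H : Set
    H = Hist k tree

    _⇝_ : H → H → Set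
    (i , s , _) ⇝ (j , t , _) = (i ≡ j) × ∃ λ e → t ≡ s ++ [ e ]

    ext : (i : Fin k) (s : List E) (e : E) → mem (tree i) (s ++ [ e ]) ≡ true → H
    ext i s e p = (i , s ++ [ e ] , p)

    SameClass : H → H → Set
    SameClass a b = ∀ x → (a ∼ x) ⇔ (b ∼ x)

    prefixes : (i : Fin k) (s : List E) → mem (tree i) s ≡ true → List H
    prefixes i s p = go [] s p
      where
        go : (acc rest : List E) → mem (tree i) (acc ++ rest) ≡ true → List H
        go acc [] q = (i , acc ++ [] , q) ∷ []
        go acc (e ∷ rest) q =
          (i , acc , pre acc e rest q) ∷ go (acc ++ [ e ]) rest (reassoc acc e rest q)
          where
            open import Data.List.Properties using (++-assoc)
            open import Relation.Binary.PropositionalEquality using (subst; sym)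
            reassoc : ∀ acc e rest → mem (tree i) (acc ++ e ∷ rest) ≡ true
                    → mem (tree i) ((acc ++ [ e ]) ++ rest) ≡ true
            reassoc acc e rest q =
              subst (λ z → mem (tree i) z ≡ true) (sym (++-assoc acc [ e ] rest)) q
            allpre : ∀ u rest → mem (tree i) (u ++ rest) ≡ true → mem (tree i) u ≡ true
            allpre u [] q' = subst (λ z → mem (tree i) z ≡ true) (Data.List.Properties.++-identityʳ u) q'
            allpre u (x ∷ rest') q' =
              closed (tree i) u x (allpre (u ++ [ x ]) rest'
                (subst (λ z → mem (tree i) z ≡ true) (sym (++-assoc u [ x ] rest')) q'))
            pre : ∀ acc e rest → mem (tree i) (acc ++ e ∷ rest) ≡ true → mem (tree i) acc ≡ true
            pre acc e rest q = allpre acc (e ∷ rest) q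

  data Collapse {A : Set} (R : A → A → Set) : List A → List A → Set where
    c[]   : Collapse R [] []
    c1    : ∀ {x} → Collapse R (x ∷ []) (x ∷ [])
    cdup  : ∀ {x y xs ys} → R x y → Collapse R (y ∷ xs) ys
          → Collapse R (x ∷ y ∷ xs) ys
    ckeep : ∀ {x y xs ys} → ¬ R x y → Collapse R (y ∷ xs) ys
          → Collapse R (x ∷ y ∷ xs) (x ∷ ys)

  data Pointwise {A : Set} (R : A → A → Set) : List A → List A → Set where
    []  : Pointwise R [] []
    _∷_ : ∀ {x y xs ys} → R x y → Pointwise R xs ys → Pointwise R (x ∷ xs) (y ∷ ys)

  Stutter≈ : {A : Set} (R : A → A → Set) → List A → List A → Set
  Stutter≈ R xs xs' = Σ _ λ ys → Σ _ λ ys' →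
    Collapse R xs ys × Collapse R xs' ys' × Pointwise R ys ys'

  module _ (F : Forest) where
    open Forest F

    -- EE(h) ≈ EE(h'), where EE(h) is the list of classes of the prefixes
    -- of h; classes are compared as sets (SameClass).
    EE≈ : H → H → Set
    EE≈ (i , s , p) (j , t , q) = Stutter≈ SameClass (prefixes i s p) (prefixes j t q)

    PR-ee : Set
    PR-ee = ∀ h h' → h ∼ h' → EE≈ h h'

    PR-hcℓ : Set
    PR-hcℓ = ∀ (i : Fin k) (s : List E) (e : E)
               (p : mem (tree i) (s ++ [ e ]) ≡ true) (h' : H) →
             let h  : H
                 h  = (i , s , closed (tree i) s e p)
                 he : H
                 he = ext i s e p
             in he ∼ h' →
                (h ∼ h')
              ⊎ (Σ H λ h'' → (h ∼ h'') × (h'' ⇝ h'))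
              ⊎ (Σ H λ h'' → (he ∼ h'') × (h'' ⇝ h'))

    PR : Set
    PR = PR-ee × PR-hcℓ

    Transitive : Set
    Transitive = ∀ a b c → a ∼ b → b ∼ c → a ∼ c

    Euclidean : Set
    Euclidean = ∀ a b c → a ∼ b → a ∼ c → b ∼ c

    Introspective : Set
    Introspective = Transitive × Euclidean

  data Form : Set where
    atom : ℕ → Form
    ¬'   : Form → Form
    _∧'_ : Form → Form → Form
    K    : Form → Form
    ⟨_⟩  : E → Form → Form

  module _ (F : Forest) where
    open Forest F

    Valuation : Set₁
    Valuation = ℕ → H → Set

    Sat : Valuation → H → Form → Set
    Sat V h (atom x)  = V x h
    Sat V h (¬' φ)    = ¬ Sat V h φ
    Sat V h (φ ∧' ψ)  = Sat V h φ × Sat V h ψ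
    Sat V h (K φ)     = ∀ h' → h ∼ h' → Sat V h' φ
    Sat V (i , s , _) (⟨ e ⟩ φ) =
      Σ (mem (tree i) (s ++ [ e ]) ≡ true) λ p → Sat V (ext i s e p) φ

    Valid : Form → Set₁
    Valid φ = ∀ (V : Valuation) (h : H) → Sat V h φ

  _⊨_ : (Form → Set) → Forest → Set₁
  Γ ⊨ F = ∀ φ → Γ φ → Valid F φ

-- The forest 𝓐 has two copies of the tree {ε, 0}; every history of the
-- first copy sees only its twin in the second copy, and the second copy sees
-- only itself.  It has PR.  Pruning the root of the first copy gives a forest
-- 𝓑 whose new root sees the leaf of the second copy; their EE sequences have
-- one and two distinct classes, so 𝓑 lacks PR.  But 𝓑 is a generated
-- subforest of 𝓐 (ETL cannot look backwards, so it cannot notice that a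
-- history is a root): the embedding is a bounded morphism with a retraction,
-- hence every formula valid on 𝓐 is valid on 𝓑.  Both forests are
-- introspective, so no Γ defines PR.
module Submission where

open import Defs
open import Data.Nat using (ℕ; suc)
open import Data.Fin using (Fin; zero; suc)
open import Data.Product using (Σ; ∃; _×_; _,_)
open import Data.Sum using (inj₁; inj₂)
open import Data.Bool using (Bool; true; false)
open import Data.List using (List; []; _∷_; _++_; [_]; null)
open import Data.List.Membership.Propositional using (_∈_)
open import Data.List.Relation.Unary.Any using (here; there)
open import Relation.Nullary using (¬_)
open import Relation.Binary.PropositionalEquality
  using (_≡_; refl; sym; trans; cong; subst)
open import Function.Bundles using (_⇔_; mk⇔; Equivalence)
open Equivalence

module _ {E : Set} where
  open ETL E

  Step : (F : Forest) → Forest.H F → E → Forest.H F → Set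
  Step F (i , s , _) e h = Σ (mem (tree i) (s ++ [ e ]) ≡ true) λ p → ext i s e p ≡ h
    where open Forest F

  Sat-⟨⟩ : ∀ F V h e φ →
           Sat F V h (⟨ e ⟩ φ) ⇔ (∃ λ h' → Step F h e h' × Sat F V h' φ)
  Sat-⟨⟩ F V (i , s , _) e φ = mk⇔
    (λ (p , sat) → _ , (p , refl) , sat)
    λ { (_ , (p , refl) , sat) → p , sat }

  record BoundedMorphism (F G : Forest) (f : Forest.H F → Forest.H G) : Set where
    private
      module F = Forest F
      module G = Forest G
    field
      ∼-forth    : ∀ {a b} → a F.∼ b → f a G.∼ f b
      ∼-back     : ∀ {a y} → f a G.∼ y → ∃ λ b → a F.∼ b × f b ≡ y
      step-forth : ∀ {a e b} → Step F a e b → Step G (f a) e (f b)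
      step-back  : ∀ {a e y} → Step G (f a) e y → ∃ λ b → Step F a e b × f b ≡ y

  module _ {F G : Forest} {f : Forest.H F → Forest.H G} (m : BoundedMorphism F G f)
           (V : Valuation F) (W : Valuation G) (V⇔W : ∀ x a → V x a ⇔ W x (f a)) where
    open BoundedMorphism m

    Sat-preserved : ∀ φ a → Sat F V a φ ⇔ Sat G W (f a) φ
    Sat-preserved (atom x) a = V⇔W x a
    Sat-preserved (¬' φ) a = mk⇔
      (λ ¬sat sat → ¬sat (from (Sat-preserved φ a) sat))
      (λ ¬sat sat → ¬sat (to (Sat-preserved φ a) sat))
    Sat-preserved (φ ∧' ψ) a = mk⇔
      (λ (sφ , sψ) → to (Sat-preserved φ a) sφ , to (Sat-preserved ψ a) sψ)
      (λ (sφ , sψ) → from (Sat-preserved φ a) sφ , from (Sat-preserved ψ a) sψ)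
    Sat-preserved (K φ) a = mk⇔
      (λ sat y a∼y → let (b , a∼b , fb≡y) = ∼-back a∼y in
        subst (λ h → Sat G W h φ) fb≡y (to (Sat-preserved φ b) (sat b a∼b)))
      (λ sat b a∼b → from (Sat-preserved φ b) (sat (f b) (∼-forth a∼b)))
    Sat-preserved (⟨ e ⟩ φ) a = mk⇔
      (λ sat → let (b , st , sb) = to (Sat-⟨⟩ F V a e φ) sat in
        from (Sat-⟨⟩ G W (f a) e φ) (f b , step-forth st , to (Sat-preserved φ b) sb))
      (λ sat → let (y , st , sy) = to (Sat-⟨⟩ G W (f a) e φ) sat
                   (b , st' , fb≡y) = step-back st in
        from (Sat-⟨⟩ F V a e φ)
          (b , st' , from (Sat-preserved φ b) (subst (λ h → Sat G W h φ) (sym fb≡y) sy)))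

  Valid-reflected : ∀ {F G f} → BoundedMorphism F G f →
                    (r : Forest.H G → Forest.H F) → (∀ a → r (f a) ≡ a) →
                    ∀ φ → Valid G φ → Valid F φ
  Valid-reflected {f = f} m r r∘f≡id φ valid V a =
    from (Sat-preserved m V (λ x y → V x (r y)) V⇔V∘r∘f φ a) (valid _ (f a))
    where
      V⇔V∘r∘f : ∀ x a → V x a ⇔ V x (r (f a))
      V⇔V∘r∘f x a = mk⇔ (subst (V x) (sym (r∘f≡id a))) (subst (V x) (r∘f≡id a))

  module _ {k : ℕ} (T : Fin k → Tree) (ρ : Hist k T → Hist k T) where

    graphForest : Forest
    graphForest = record { k = k ; tree = T ; _∼_ = λ a b → ρ a ≡ b }

    open Forest graphForest using (SameClass)

    graph-introspective : (∀ a → ρ (ρ a) ≡ ρ a) → Introspective graphForest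
    graph-introspective idem =
      (λ a b c ρa≡b ρb≡c → trans (sym (idem a)) (trans (cong ρ ρa≡b) ρb≡c)) ,
      (λ a b c ρa≡b ρa≡c → trans (cong ρ (sym ρa≡b)) (trans (idem a) ρa≡c))

    graph-sameClass : ∀ a b → ρ a ≡ ρ b → SameClass a b
    graph-sameClass a b ρa≡ρb x = mk⇔ (trans (sym ρa≡ρb)) (trans ρa≡ρb)

    graph-sameClasses : ∀ {xs ys} → Pointwise (λ a b → ρ a ≡ ρ b) xs ys →
                        Pointwise SameClass xs ys
    graph-sameClasses [] = []
    graph-sameClasses (_∷_ {a} {b} ρa≡ρb rest) =
      graph-sameClass a b ρa≡ρb ∷ graph-sameClasses rest

    graph-sameClass⁻¹ : ∀ a b → SameClass a b → ρ a ≡ ρ b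
    graph-sameClass⁻¹ a b same = sym (to (same (ρ a)) refl)

    graph-ckeep : ∀ {a b xs ys} → ¬ ρ a ≡ ρ b → Collapse SameClass (b ∷ xs) ys →
                  Collapse SameClass (a ∷ b ∷ xs) (a ∷ ys)
    graph-ckeep {a} {b} ρa≢ρb = ckeep λ same → ρa≢ρb (graph-sameClass⁻¹ a b same)

  module _ {k l : ℕ} {T : Fin k → Tree} {U : Fin l → Tree}
           {ρ : Hist k T → Hist k T} {σ : Hist l U → Hist l U} where
    private
      F G : Forest
      F = graphForest T ρ
      G = graphForest U σ

    graph-morphism : (f : Hist k T → Hist l U) → (∀ a → f (ρ a) ≡ σ (f a)) →
                     (∀ {a e b} → Step F a e b → Step G (f a) e (f b)) →
                     (∀ {a e y} → Step G (f a) e y → ∃ λ b → Step F a e b × f b ≡ y) →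
                     BoundedMorphism F G f
    graph-morphism f commute forth back = record
      { ∼-forth    = λ {a} ρa≡b → trans (sym (commute a)) (cong f ρa≡b)
      ; ∼-back     = λ {a} σfa≡y → ρ a , refl , trans (commute a) σfa≡y
      ; step-forth = forth
      ; step-back  = back
      }

module Counterexample (n : ℕ) where
  open ETL (Fin (suc n))

  pointTree : Tree
  pointTree = record { mem = null ; root = refl ; closed = null-closed
                     ; finite = [ [] ] , null-listed }
    where
      null-closed : ∀ s e → null (s ++ [ e ]) ≡ true → null s ≡ true
      null-closed [] _ ()
      null-closed (_ ∷ _) _ ()
      null-listed : ∀ s → null s ≡ true → s ∈ [ [] ]
      null-listed [] _ = here refl

  edgeTree : Tree
  edgeTree = record { mem = inEdge ; root = refl ; closed = inEdge-closed
                    ; finite = [] ∷ [ zero ] ∷ [] , inEdge-listed }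
    where
      inEdge : List (Fin (suc n)) → Bool
      inEdge [] = true
      inEdge (zero ∷ []) = true
      inEdge _ = false
      inEdge-closed : ∀ s e → inEdge (s ++ [ e ]) ≡ true → inEdge s ≡ true
      inEdge-closed [] _ _ = refl
      inEdge-closed (zero ∷ []) _ ()
      inEdge-closed (zero ∷ _ ∷ _) _ ()
      inEdge-closed (suc _ ∷ _) _ ()
      inEdge-listed : ∀ s → inEdge s ≡ true → s ∈ [] ∷ [ zero ] ∷ []
      inEdge-listed [] _ = here refl
      inEdge-listed (zero ∷ []) _ = there (here refl)

  twinTrees : Fin 2 → Tree
  twinTrees _ = edgeTree

  prunedTrees : Fin 2 → Tree
  prunedTrees zero = pointTree
  prunedTrees (suc _) = edgeTree

  toSecondTwin : Hist 2 twinTrees → Hist 2 twinTrees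
  toSecondTwin (_ , s , p) = suc zero , s , p

  toSecondPruned : Hist 2 prunedTrees → Hist 2 prunedTrees
  toSecondPruned (zero , [] , _) = suc zero , [ zero ] , refl
  toSecondPruned (suc _ , s , p) = suc zero , s , p

  𝓐 : Forest
  𝓐 = graphForest twinTrees toSecondTwin

  𝓑 : Forest
  𝓑 = graphForest prunedTrees toSecondPruned

  𝓐-introspective : Introspective 𝓐
  𝓐-introspective = graph-introspective twinTrees toSecondTwin λ _ → refl

  𝓑-introspective : Introspective 𝓑
  𝓑-introspective = graph-introspective prunedTrees toSecondPruned λ
    { (zero , [] , _) → refl
    ; (suc _ , _ , _) → refl }

  𝓐-PR-ee : PR-ee 𝓐
  𝓐-PR-ee (_ , [] , refl) _ refl =
    _ , _ , c1 , c1 , graph-sameClasses twinTrees toSecondTwin (refl ∷ [])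
  𝓐-PR-ee (_ , zero ∷ [] , refl) _ refl =
    _ , _ , graph-ckeep twinTrees toSecondTwin (λ ()) c1 ,
    graph-ckeep twinTrees toSecondTwin (λ ()) c1 ,
    graph-sameClasses twinTrees toSecondTwin (refl ∷ refl ∷ [])

  𝓐-PR-hcℓ : PR-hcℓ 𝓐
  𝓐-PR-hcℓ _ [] zero refl _ refl =
    inj₂ (inj₁ ((suc zero , [] , refl) , refl , refl , zero , refl))
  𝓐-PR-hcℓ _ [] (suc _) ()
  𝓐-PR-hcℓ _ (zero ∷ []) _ ()
  𝓐-PR-hcℓ _ (zero ∷ _ ∷ _) _ ()
  𝓐-PR-hcℓ _ (suc _ ∷ _) _ ()

  𝓐-PR : PR 𝓐
  𝓐-PR = 𝓐-PR-ee , 𝓐-PR-hcℓ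

  𝓑-root≁leaf : ¬ Forest.SameClass 𝓑 (suc zero , [] , refl) (suc zero , [ zero ] , refl)
  𝓑-root≁leaf same
    with graph-sameClass⁻¹ prunedTrees toSecondPruned
           (suc zero , [] , refl) (suc zero , [ zero ] , refl) same
  ... | ()

  𝓑-¬PR : ¬ PR 𝓑
  𝓑-¬PR (ee , _) with ee (zero , [] , refl) (suc zero , [ zero ] , refl) refl
  ... | _ , _ , c1 , cdup same c1 , _ = 𝓑-root≁leaf same
  ... | _ , _ , c1 , ckeep _ c1 , _ ∷ ()

  embed : Hist 2 prunedTrees → Hist 2 twinTrees
  embed (zero , [] , _) = zero , [ zero ] , refl
  embed (suc i , s , p) = suc i , s , p

  retract : Hist 2 twinTrees → Hist 2 prunedTrees
  retract (zero , _ , _) = zero , [] , refl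
  retract (suc i , s , p) = suc i , s , p

  retract-embed : ∀ h → retract (embed h) ≡ h
  retract-embed (zero , [] , refl) = refl
  retract-embed (suc _ , _ , _) = refl

  embed-bounded : BoundedMorphism 𝓑 𝓐 embed
  embed-bounded = graph-morphism embed commute forth back
    where
      commute : ∀ a → embed (toSecondPruned a) ≡ toSecondTwin (embed a)
      commute (zero , [] , _) = refl
      commute (suc _ , _ , _) = refl
      forth : ∀ {a e b} → Step 𝓑 a e b → Step 𝓐 (embed a) e (embed b)
      forth {zero , [] , _} (() , _)
      forth {suc _ , _ , _} (q , refl) = q , refl
      back : ∀ {a e y} → Step 𝓐 (embed a) e y → ∃ λ b → Step 𝓑 a e b × embed b ≡ y
      back {zero , [] , _} (() , _)
      back {suc _ , _ , _} (q , refl) = _ , (q , refl) , refl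

  not-definable : ¬ (Σ (Form → Set) λ Γ →
                    ∀ F → Introspective F → ((Γ ⊨ F) ⇔ PR F))
  not-definable (Γ , defines) = 𝓑-¬PR (to (defines 𝓑 𝓑-introspective) Γ⊨𝓑)
    where
      Γ⊨𝓑 : Γ ⊨ 𝓑
      Γ⊨𝓑 φ φ∈Γ = Valid-reflected embed-bounded retract retract-embed φ
                    (from (defines 𝓐 𝓐-introspective) 𝓐-PR φ φ∈Γ)

proposition8 : (n : ℕ) → let open ETL (Fin (suc n)) in
    ¬ (Σ (Form → Set) λ Γ → ∀ (F : Forest) → Introspective F → ((Γ ⊨ F) ⇔ PR F))
    × ¬ (Σ (Form → Set) λ Γ → ∀ (F : Forest) → ((Γ ⊨ F) ⇔ PR F))
proposition8 n =
  not-definable , λ (Γ , defines) → not-definable (Γ , λ F _ → defines F)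
  where open Counterexample n
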